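{- Let $y\in{}^\omega(\omega\setminus\{0\})$ be strictly increasing and let $T$ and $T'$ be $y$-squeezed trees. Then $T\cup T'$ is a $y$-squeezed tree.
   Context: Trees are subsets of ${}^{<\omega}\omega$ closed under initial segments. For $y$ strictly increasing and $n\in\omega$, $(j,k,m)$ is a $y$-bound system above $n$ iff $k\in\omega$, $j,m$ are functions from $\{0,\dots,k\}$ into $\omega$, $j(0)>y(n+m(0)+1)$, and for all $l<k$, $j(l+1)>y(j(l)+m(l+1)+1)$. A tree $T$ is $(j,k,m,\eta)$-squeezed iff $T$ has no terminal nodes, $\mathrm{dom}(\eta)=\{(l,t): l\le k,\ t\le m(l)\}$, $\eta(l,t)\in{}^{j(l)}\omega$, and every $\nu\in T$ is comparable (one is an initial segment of the other) with some $\eta(l,t)$. $T$ is $y$-squeezed iff for every $n$ there is a $y$-bound system $(j,k,m)$ above $n$ and $\eta$ with $T$ $(j,k,m,\eta)$-squeezed. -}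

module Defs where

open import Data.Nat using (ℕ; suc; _+_; _<_; _≤_)
open import Data.List using (List; _++_; [_]; length)
open import Data.Product using (Σ; ∃; ∃-syntax; _×_)
open import Data.Sum using (_⊎_)
open import Relation.Binary.PropositionalEquality using (_≡_)

Seq : Set
Seq = List ℕ

_⊑_ : Seq → Seq → Set
u ⊑ v = ∃[ w ] (u ++ w ≡ v)

Comparable : Seq → Seq → Set
Comparable u v = (u ⊑ v) ⊎ (v ⊑ u)

SeqSet : Set₁
SeqSet = Seq → Set

IsTree : SeqSet → Set
IsTree T = ∀ u v → u ⊑ v → T v → T u

_∪_ : SeqSet → SeqSet → SeqSet
(T ∪ T') ν = T ν ⊎ T' ν

StrictlyIncreasing : (ℕ → ℕ) → Set
StrictlyIncreasing y = ∀ n → y n < y (suc n)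

-- (j,k,m) is a y-bound system above n.  j and m are functions on {0,…,k};
-- we represent them as functions ℕ → ℕ whose values outside {0,…,k} are irrelevant.
BoundSystem : (y : ℕ → ℕ) (n : ℕ) (j : ℕ → ℕ) (k : ℕ) (m : ℕ → ℕ) → Set
BoundSystem y n j k m =
  (y (n + m 0 + 1) < j 0) ×
  (∀ l → l < k → y (j l + m (suc l) + 1) < j (suc l))

NoTerminal : SeqSet → Set
NoTerminal T = ∀ ν → T ν → ∃[ a ] T (ν ++ [ a ])

Squeezed : (T : SeqSet) (j : ℕ → ℕ) (k : ℕ) (m : ℕ → ℕ)
           (η : (l : ℕ) → l ≤ k → (t : ℕ) → t ≤ m l → Seq) → Set
Squeezed T j k m η =
  NoTerminal T ×
  (∀ l (hl : l ≤ k) t (ht : t ≤ m l) → length (η l hl t ht) ≡ j l) ×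
  (∀ ν → T ν → ∃[ l ] Σ (l ≤ k) λ hl → ∃[ t ] Σ (t ≤ m l) λ ht →
      Comparable ν (η l hl t ht))

YSqueezed : (y : ℕ → ℕ) → SeqSet → Set
YSqueezed y T = ∀ n → ∃[ j ] ∃[ k ] ∃[ m ]
  (BoundSystem y n j k m ×
   ∃[ η ] Squeezed T j k m η)

-- Squeeze T by a y-bound system above n; it ends at level j k.  Squeeze T′ by a
-- y-bound system above j k.  Its first bound condition, y (j k + m′ 0 + 1) < j′ 0, is
-- exactly the link condition needed at the seam, so the two systems laid end to end
-- form one y-bound system above n, and the two families η, η′ laid end to end squeeze
-- T ∪ T′: each node of T ∪ T′ is comparable with a node of η or of η′.
module Submission where

open import Defs
open import Data.Nat using (ℕ; zero; suc; _+_; _<_; _≤_; z≤n; s≤s)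
open import Data.List using (length)
open import Data.Product using (_×_; Σ; ∃-syntax; _,_)
open import Data.Sum using (inj₁; inj₂)
open import Function using (_∘_)
open import Relation.Binary.PropositionalEquality using (_≡_)

∪-isTree : {T T′ : SeqSet} → IsTree T → IsTree T′ → IsTree (T ∪ T′)
∪-isTree tree _     u v u⊑v (inj₁ Tv)  = inj₁ (tree u v u⊑v Tv)
∪-isTree _    tree′ u v u⊑v (inj₂ T′v) = inj₂ (tree′ u v u⊑v T′v)

∪-noTerminal : {T T′ : SeqSet} → NoTerminal T → NoTerminal T′ → NoTerminal (T ∪ T′)
∪-noTerminal nt _   ν (inj₁ Tν) with nt ν Tν
... | a , Tνa = a , inj₁ Tνa
∪-noTerminal _ nt′ ν (inj₂ T′ν) with nt′ ν T′ν
... | a , T′νa = a , inj₂ T′νa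

-- splice k f g lists f 0, …, f k and then g 0, g 1, …
-- Recursing on k rather than testing l ≤ k lets the spliced conditions below hold by
-- computation, with no transports.
splice : {A : Set} → ℕ → (ℕ → A) → (ℕ → A) → ℕ → A
splice k       f g zero    = f zero
splice zero    f g (suc l) = g l
splice (suc k) f g (suc l) = splice k (f ∘ suc) g l

module _ {A : Set} (P : A → Set) where

  spliceᵈ : (k : ℕ) (m m′ : ℕ → A) {k′ : ℕ} →
    ((l : ℕ) → l ≤ k → P (m l)) → ((d : ℕ) → d ≤ k′ → P (m′ d)) →
    (l : ℕ) → l ≤ suc (k + k′) → P (splice k m m′ l)
  spliceᵈ k       m m′ f g zero    _          = f zero z≤n
  spliceᵈ zero    m m′ f g (suc d) (s≤s d≤k′) = g d d≤k′
  spliceᵈ (suc k) m m′ f g (suc l) (s≤s l≤)   =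
    spliceᵈ k (m ∘ suc) m′ (λ i i≤k → f (suc i) (s≤s i≤k)) g l l≤

  spliceᵈ-pointwise : {B : Set} (Q : B → (a : A) → P a → Set)
    (k : ℕ) {k′ : ℕ} (j j′ : ℕ → B) (m m′ : ℕ → A)
    {f : (l : ℕ) → l ≤ k → P (m l)} {g : (d : ℕ) → d ≤ k′ → P (m′ d)} →
    (∀ l l≤k → Q (j l) (m l) (f l l≤k)) → (∀ d d≤k′ → Q (j′ d) (m′ d) (g d d≤k′)) →
    ∀ l l≤ → Q (splice k j j′ l) (splice k m m′ l) (spliceᵈ k m m′ f g l l≤)
  spliceᵈ-pointwise Q k       j j′ m m′ qf qg zero    _          = qf zero z≤n
  spliceᵈ-pointwise Q zero    j j′ m m′ qf qg (suc d) (s≤s d≤k′) = qg d d≤k′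
  spliceᵈ-pointwise Q (suc k) j j′ m m′ qf qg (suc l) (s≤s l≤)   =
    spliceᵈ-pointwise Q k (j ∘ suc) j′ (m ∘ suc) m′ (λ i i≤k → qf (suc i) (s≤s i≤k)) qg l l≤

  HitBySplice : (R : (a : A) → P a → Set) (k : ℕ) (m m′ : ℕ → A) {k′ : ℕ} →
    ((l : ℕ) → l ≤ k → P (m l)) → ((d : ℕ) → d ≤ k′ → P (m′ d)) → Set
  HitBySplice R k m m′ {k′} f g =
    ∃[ i ] Σ (i ≤ suc (k + k′)) λ i≤ → R (splice k m m′ i) (spliceᵈ k m m′ f g i i≤)

  hitBySplice-suc : (R : (a : A) → P a → Set) (k : ℕ) (m m′ : ℕ → A) {k′ : ℕ}
    {f : (l : ℕ) → l ≤ suc k → P (m l)} {g : (d : ℕ) → d ≤ k′ → P (m′ d)} →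
    HitBySplice R k (m ∘ suc) m′ (λ i i≤k → f (suc i) (s≤s i≤k)) g →
    HitBySplice R (suc k) m m′ f g
  hitBySplice-suc R k m m′ (i , i≤ , r) = suc i , s≤s i≤ , r

  spliceᵈ-coversˡ : (R : (a : A) → P a → Set) (k : ℕ) (m m′ : ℕ → A) {k′ : ℕ}
    {f : (l : ℕ) → l ≤ k → P (m l)} {g : (d : ℕ) → d ≤ k′ → P (m′ d)} →
    ∀ l (l≤k : l ≤ k) → R (m l) (f l l≤k) → HitBySplice R k m m′ f g
  spliceᵈ-coversˡ R k       m m′ zero    z≤n       r = zero , z≤n , r
  spliceᵈ-coversˡ R (suc k) m m′ (suc l) (s≤s l≤k) r =
    hitBySplice-suc R k m m′ (spliceᵈ-coversˡ R k (m ∘ suc) m′ l l≤k r)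

  spliceᵈ-coversʳ : (R : (a : A) → P a → Set) (k : ℕ) (m m′ : ℕ → A) {k′ : ℕ}
    {f : (l : ℕ) → l ≤ k → P (m l)} {g : (d : ℕ) → d ≤ k′ → P (m′ d)} →
    ∀ d (d≤k′ : d ≤ k′) → R (m′ d) (g d d≤k′) → HitBySplice R k m m′ f g
  spliceᵈ-coversʳ R zero    m m′ d d≤k′ r = suc d , s≤s d≤k′ , r
  spliceᵈ-coversʳ R (suc k) m m′ d d≤k′ r =
    hitBySplice-suc R k m m′ (spliceᵈ-coversʳ R k (m ∘ suc) m′ d d≤k′ r)

LinkedBounds : (y j : ℕ → ℕ) (k : ℕ) (m : ℕ → ℕ) → Set
LinkedBounds y j k m = ∀ l → l < k → y (j l + m (suc l) + 1) < j (suc l)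

linkedBounds-splice : (y : ℕ → ℕ) (k : ℕ) {k′ : ℕ} (j j′ m m′ : ℕ → ℕ) →
  LinkedBounds y j k m → y (j k + m′ 0 + 1) < j′ 0 → LinkedBounds y j′ k′ m′ →
  LinkedBounds y (splice k j j′) (suc (k + k′)) (splice k m m′)
linkedBounds-splice y zero    j j′ m m′ _    seam _     zero    _         = seam
linkedBounds-splice y zero    j j′ m m′ _    _    links′ (suc d) (s≤s d<k′) = links′ d d<k′
linkedBounds-splice y (suc k) j j′ m m′ links _   _      zero    _         = links zero (s≤s z≤n)
linkedBounds-splice y (suc k) j j′ m m′ links seam links′ (suc l) (s≤s l<) =
  linkedBounds-splice y k (j ∘ suc) j′ (m ∘ suc) m′
    (λ i i<k → links (suc i) (s≤s i<k)) seam links′ l l<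

boundSystem-splice : (y : ℕ → ℕ) {n : ℕ} (k : ℕ) {k′ : ℕ} (j j′ m m′ : ℕ → ℕ) →
  BoundSystem y n j k m → BoundSystem y (j k) j′ k′ m′ →
  BoundSystem y n (splice k j j′) (suc (k + k′)) (splice k m m′)
boundSystem-splice y k j j′ m m′ (start , links) (seam , links′) =
  start , linkedBounds-splice y k j j′ m m′ links seam links′

Row : ℕ → Set
Row a = (t : ℕ) → t ≤ a → Seq

squeezed-∪ : {T T′ : SeqSet} {k k′ : ℕ} {j j′ m m′ : ℕ → ℕ}
  {η : (l : ℕ) → l ≤ k → Row (m l)} {η′ : (d : ℕ) → d ≤ k′ → Row (m′ d)} →
  Squeezed T j k m η → Squeezed T′ j′ k′ m′ η′ →
  Squeezed (T ∪ T′) (splice k j j′) (suc (k + k′)) (splice k m m′) (spliceᵈ Row k m m′ η η′)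
squeezed-∪ {k = k} {j = j} {j′} {m} {m′} (nt , lengths , covers) (nt′ , lengths′ , covers′) =
  ∪-noTerminal nt nt′ ,
  spliceᵈ-pointwise Row HasLength k j j′ m m′ lengths lengths′ ,
  λ where
    ν (inj₁ Tν)  → let l , l≤k , t , t≤ , c = covers ν Tν in
      spliceᵈ-coversˡ Row (MeetsRow ν) k m m′ l l≤k (t , t≤ , c)
    ν (inj₂ T′ν) → let d , d≤k′ , t , t≤ , c = covers′ ν T′ν in
      spliceᵈ-coversʳ Row (MeetsRow ν) k m m′ d d≤k′ (t , t≤ , c)
  where
  HasLength : ℕ → (a : ℕ) → Row a → Set
  HasLength len a row = ∀ t t≤a → length (row t t≤a) ≡ len

  MeetsRow : Seq → (a : ℕ) → Row a → Set
  MeetsRow ν a row = ∃[ t ] Σ (t ≤ a) λ t≤a → Comparable ν (row t t≤a)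

lemma7p10 : (y : ℕ → ℕ) → (∀ n → 0 < y n) → StrictlyIncreasing y →
    (T T' : SeqSet) → IsTree T → IsTree T' → YSqueezed y T → YSqueezed y T' →
    IsTree (T ∪ T') × YSqueezed y (T ∪ T')
lemma7p10 y _ _ T T' tree tree′ squeezed squeezed′ = ∪-isTree tree tree′ , squeezed-∪-above
  where
  squeezed-∪-above : YSqueezed y (T ∪ T')
  squeezed-∪-above n with squeezed n
  ... | j , k , m , bounds , η , sq with squeezed′ (j k)
  ...   | j′ , k′ , m′ , bounds′ , η′ , sq′ =
    splice k j j′ , suc (k + k′) , splice k m m′ ,
    boundSystem-splice y k j j′ m m′ bounds bounds′ , spliceᵈ Row k m m′ η η′ , squeezed-∪ sq sq′
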